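{- Let $n\ge1$ and consider the Ziggu state graph on $n$ digits (defined in the context). There is exactly one solution with the fewest states. It is produced by the following rule. Start at $0^n$. At each subsequent step, among the moves from the current state that do not return to the immediately preceding state, make the one that changes the leftmost digit, i.e. the digit $q_i$ with largest index $i$. Continue until $3^n$ is reached.
   Context: Write strings over $\{0,1,2,3\}$ as $q=q_nq_{n-1}\cdots q_1$, where $q_1$ is the rightmost digit. A state is such a string in which every digit to the right of a $3$ is also a $3$. Two states $q,q'$ are adjacent (one move apart) iff they agree except in one position $i$, where $\{q_i,q'_i\}=\{a,a+1\}$ for some $a\in\{0,1,2\}$, and, if $i\ge2$, the common digit $q_{i-1}$ equals $3$ when $a$ is even and equals $0$ when $a$ is odd. A solution is a sequence of pairwise distinct states from $0^n$ to $3^n$ in which consecutive states are adjacent. -}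

module Defs where

open import Data.Nat using (ℕ; zero; suc; _≤_; _<_)
open import Data.Fin using (Fin; zero; suc; toℕ; inject₁)
open import Data.Vec using (Vec; lookup; replicate)
open import Data.List using (List; []; _∷_; length; head; last)
open import Data.List.Relation.Unary.All using (All)
open import Data.List.Relation.Unary.Linked using (Linked)
open import Data.List.Relation.Unary.Unique.Propositional using (Unique)
open import Data.Maybe using (Maybe; just; nothing)
open import Data.Product using (Σ; _×_; ∃)
open import Data.Sum using (_⊎_)
open import Data.Unit using (⊤)
open import Relation.Binary.PropositionalEquality using (_≡_; _≢_)

-- A string q = q_n ... q_1 over {0,1,2,3} is a Vec (Fin 4) n;
-- position i : Fin n holds the digit q_{toℕ i + 1} (so position zero is q_1, the rightmost digit).
Word : ℕ → Set
Word n = Vec (Fin 4) n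

three : Fin 4
three = suc (suc (suc zero))

bottom : (n : ℕ) → Word n
bottom n = replicate n zero

top : (n : ℕ) → Word n
top n = replicate n three

IsState : ∀ {n} → Word n → Set
IsState {n} q = ∀ (i j : Fin n) → toℕ j < toℕ i → lookup q i ≡ three → lookup q j ≡ three

-- the digit required at position i-1 when moving position i between a and a+1:
-- 3 when a is even, 0 when a is odd
required : Fin 3 → Fin 4
required zero = three
required (suc zero) = zero
required (suc (suc zero)) = three

AdjAt : ∀ {n} → Fin n → Word n → Word n → Set
AdjAt {n} i q q' =
  Σ (Fin 3) λ a →
    (∀ (j : Fin n) → j ≢ i → lookup q j ≡ lookup q' j)
    × ((lookup q i ≡ inject₁ a × lookup q' i ≡ suc a) ⊎ (lookup q i ≡ suc a × lookup q' i ≡ inject₁ a))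
    × (∀ (j : Fin n) → suc (toℕ j) ≡ toℕ i → lookup q j ≡ required a)

Adj : ∀ {n} → Word n → Word n → Set
Adj {n} q q' = Σ (Fin n) λ i → AdjAt i q q'

Solution : ∀ {n} → List (Word n) → Set
Solution {n} s =
  All IsState s × Unique s × Linked Adj s
  × head s ≡ just (bottom n) × last s ≡ just (top n)

NotPrev : ∀ {n} → Maybe (Word n) → Word n → Set
NotPrev nothing r = ⊤
NotPrev (just p) r = r ≢ p

GreedyMove : ∀ {n} → Maybe (Word n) → Word n → Word n → Set
GreedyMove {n} p c c' =
  IsState c' × NotPrev p c' ×
  Σ (Fin n) λ i → AdjAt i c c' ×
    (∀ (j : Fin n) (r : Word n) → IsState r → AdjAt j c r → NotPrev p r → toℕ j ≤ toℕ i)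

data GreedyWalk {n : ℕ} : Maybe (Word n) → Word n → List (Word n) → Set where
  stop : ∀ {p} → GreedyWalk p (top n) []
  step : ∀ {p c c' rest} → c ≢ top n → GreedyMove p c c' →
         GreedyWalk (just c) c' rest → GreedyWalk p c (c' ∷ rest)

data Greedy {n : ℕ} : List (Word n) → Set where
  start : ∀ {rest} → GreedyWalk nothing (bottom n) rest → Greedy (bottom n ∷ rest)

module Submission where

-- A state on n digits is 3ⁿ or a leading digit d ∈ {0,1,2} followed by a state on n-1 digits, and a
-- move either happens behind the leading digit or changes it: 0↔1 and 2↔3 need the rest to be 3ⁿ⁻¹,
-- 1↔2 needs the rest to lead with 0. By recursion on this shape we define three potentials that change
-- by at most one per move: aboveFloor (0 on the states leading with 0), belowTop (0 at 3ⁿ) and height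
-- (0 at 0ⁿ, maxHeight at 3ⁿ). So every solution makes at least maxHeight moves, and one making exactly
-- maxHeight moves raises the height at every step. The heart of the matter is that a height-raising move
-- beats every other move that does not lower the height: that move is the same one or changes a lower
-- digit. This makes the height-raising move unique, hence the shortest solution unique, and it is the
-- greedy rule, because the only height-lowering move is the one back to the previous state. Along the
-- route from 0ⁿ a height-raising move always exists, which yields the solution.

open import Defs
open import Data.Nat using (ℕ; zero; suc; _+_; _≤_; _<_; _≥_; z≤n; s≤s)
open import Data.Nat.Properties
open import Data.Fin using (Fin; zero; suc; toℕ; fromℕ; inject₁)
open import Data.Fin.Properties
  using (toℕ-fromℕ; toℕ-inject₁; toℕ<n; inject₁-injective; fromℕ≢inject₁)
open import Data.Fin.Relation.Unary.Top using (view; ‵fromℕ; ‵inject₁)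
open import Data.Vec using (Vec; []; _∷_; lookup; replicate; _∷ʳ_; initLast)
open import Data.Vec.Properties using (∷ʳ-injective; lookup-replicate; tabulate∘lookup; tabulate-cong)
open import Data.List using (List; []; _∷_; length; map; last)
open import Data.List.Properties using (last-map; length-map)
open import Data.List.Relation.Unary.All using (All; []; _∷_; universal)
open import Data.List.Relation.Unary.All.Properties using () renaming (map⁺ to All-map⁺)
import Data.List.Relation.Unary.AllPairs as AllPairs
open import Data.List.Relation.Unary.Linked as Linked using (Linked; [-]; _∷_)
open import Data.List.Relation.Unary.Linked.Properties
  using (Linked⇒AllPairs) renaming (map⁺ to Linked-map⁺; map⁻ to Linked-map⁻)
open import Data.List.Relation.Unary.Unique.Propositional using (Unique)
open import Data.List.Relation.Unary.Unique.Propositional.Properties using () renaming (map⁺ to Unique-map⁺)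
open import Data.Maybe using (Maybe; just; nothing)
import Data.Maybe as Maybe
open import Data.Maybe.Properties using (just-injective; map-injective)
open import Data.Empty using (⊥; ⊥-elim)
open import Data.Unit using (⊤; tt)
open import Data.Product using (Σ; ∃; _×_; _,_)
open import Data.Sum using (_⊎_; inj₁; inj₂; map₁)
open import Relation.Binary.PropositionalEquality
open import Function using (_∘_)

private variable
  A : Set
  m p q : ℕ

-- States and moves

data State : ℕ → Set where
  []   : State zero
  all3 : State (suc m)
  0∷_ 1∷_ 2∷_ : State m → State (suc m)

threes zeros : ∀ m → State m
threes zero = []
threes (suc m) = all3
zeros zero = []
zeros (suc m) = 0∷ zeros m

data Leading0 : State m → Set where
  []  : Leading0 []
  0∷_ : (w : State m) → Leading0 (0∷ w)

-- Move p u v: u and v differ in the digit at position p, counted from 0 at the rightmost digit.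
-- Moving the rightmost digit (m = 0) has no side condition: [] is threes 0 and satisfies Leading0.
data Move : {m : ℕ} → ℕ → State m → State m → Set where
  in0  : {u v : State m} → Move p u v → Move p (0∷ u) (0∷ v)
  in1  : {u v : State m} → Move p u v → Move p (1∷ u) (1∷ v)
  in2  : {u v : State m} → Move p u v → Move p (2∷ u) (2∷ v)
  up01 : Move m (0∷ threes m) (1∷ threes m)
  dn10 : Move m (1∷ threes m) (0∷ threes m)
  up12 : {w : State m} → Leading0 w → Move m (1∷ w) (2∷ w)
  dn21 : {w : State m} → Leading0 w → Move m (2∷ w) (1∷ w)
  up23 : Move m (2∷ threes m) all3
  dn32 : Move m all3 (2∷ threes m)

Move-sym : {u v : State m} → Move p u v → Move p v u
Move-sym (in0 a) = in0 (Move-sym a)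
Move-sym (in1 a) = in1 (Move-sym a)
Move-sym (in2 a) = in2 (Move-sym a)
Move-sym up01 = dn10
Move-sym dn10 = up01
Move-sym (up12 z) = dn21 z
Move-sym (dn21 z) = up12 z
Move-sym up23 = dn32
Move-sym dn32 = up23

Move-irrefl : {u : State m} → Move p u u → ⊥
Move-irrefl (in0 a) = Move-irrefl a
Move-irrefl (in1 a) = Move-irrefl a
Move-irrefl (in2 a) = Move-irrefl a

Move⇒position< : {u v : State m} → Move p u v → p < m
Move⇒position< (in0 a) = m≤n⇒m≤1+n (Move⇒position< a)
Move⇒position< (in1 a) = m≤n⇒m≤1+n (Move⇒position< a)
Move⇒position< (in2 a) = m≤n⇒m≤1+n (Move⇒position< a)
Move⇒position< up01 = ≤-refl
Move⇒position< dn10 = ≤-refl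
Move⇒position< (up12 _) = ≤-refl
Move⇒position< (dn21 _) = ≤-refl
Move⇒position< up23 = ≤-refl
Move⇒position< dn32 = ≤-refl

Move-position-unique : {u v : State m} → Move p u v → Move q u v → p ≡ q
Move-position-unique (in0 a) (in0 b) = Move-position-unique a b
Move-position-unique (in1 a) (in1 b) = Move-position-unique a b
Move-position-unique (in2 a) (in2 b) = Move-position-unique a b
Move-position-unique up01 up01 = refl
Move-position-unique dn10 dn10 = refl
Move-position-unique (up12 _) (up12 _) = refl
Move-position-unique (dn21 _) (dn21 _) = refl
Move-position-unique up23 up23 = refl
Move-position-unique dn32 dn32 = refl

-- Potentials

-- The summand that varies is always on the left, so that (since _+_ recurses on its left argument)
-- an equation between potentials of two states with the same leading digit cancels with +-cancelʳ-≡.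
gap : ℕ → ℕ
gap zero = 0
gap (suc m) = suc (gap m + suc (suc (gap m)))

aboveFloor belowTop : State m → ℕ
aboveFloor [] = 0
aboveFloor {suc m} all3 = gap (suc m)
aboveFloor (0∷ w) = 0
aboveFloor (1∷ w) = suc (belowTop w)
aboveFloor {suc m} (2∷ w) = aboveFloor w + suc (suc (gap m))
belowTop [] = 0
belowTop all3 = 0
belowTop {suc m} (0∷ w) = gap (suc m)
belowTop {suc m} (1∷ w) = aboveFloor w + suc (suc (gap m))
belowTop (2∷ w) = suc (belowTop w)

maxHeight : ℕ → ℕ
maxHeight zero = 0
maxHeight (suc m) = suc (gap m + suc (gap m + suc (maxHeight m)))

height : State m → ℕ
height [] = 0
height {suc m} all3 = maxHeight (suc m)
height (0∷ w) = height w
height {suc m} (1∷ w) = belowTop w + suc (maxHeight m)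
height {suc m} (2∷ w) = aboveFloor w + suc (gap m + suc (maxHeight m))

aboveFloor-threes : ∀ m → aboveFloor (threes m) ≡ gap m
aboveFloor-threes zero = refl
aboveFloor-threes (suc m) = refl

belowTop-threes : ∀ m → belowTop (threes m) ≡ 0
belowTop-threes zero = refl
belowTop-threes (suc m) = refl

belowTop-leading0 : {w : State m} → Leading0 w → belowTop w ≡ gap m
belowTop-leading0 [] = refl
belowTop-leading0 (0∷ w) = refl

height-threes : ∀ m → height (threes m) ≡ maxHeight m
height-threes zero = refl
height-threes (suc m) = refl

height-zeros : ∀ m → height (zeros m) ≡ 0
height-zeros zero = refl
height-zeros (suc m) = height-zeros m

aboveFloor≤gap : (w : State m) → aboveFloor w ≤ gap m
belowTop≤gap : (w : State m) → belowTop w ≤ gap m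
aboveFloor≤gap [] = z≤n
aboveFloor≤gap all3 = ≤-refl
aboveFloor≤gap (0∷ w) = z≤n
aboveFloor≤gap {suc m} (1∷ w) = s≤s (≤-trans (belowTop≤gap w) (m≤m+n (gap m) _))
aboveFloor≤gap {suc m} (2∷ w) = m≤n⇒m≤1+n (+-monoˡ-≤ _ (aboveFloor≤gap w))
belowTop≤gap [] = z≤n
belowTop≤gap all3 = z≤n
belowTop≤gap (0∷ w) = ≤-refl
belowTop≤gap {suc m} (1∷ w) = m≤n⇒m≤1+n (+-monoˡ-≤ _ (aboveFloor≤gap w))
belowTop≤gap {suc m} (2∷ w) = s≤s (≤-trans (belowTop≤gap w) (m≤m+n (gap m) _))

maxHeight<maxHeight-suc : ∀ m → maxHeight m < maxHeight (suc m)
maxHeight<maxHeight-suc m = s≤s (m≤n⇒m≤o+n (gap m) (m≤n⇒m≤1+n (m≤n⇒m≤o+n (gap m) (n≤1+n _))))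

height-1∷≤ : (w : State m) → height (1∷ w) ≤ gap m + suc (maxHeight m)
height-1∷≤ w = +-monoˡ-≤ _ (belowTop≤gap w)

height≤maxHeight : (w : State m) → height w ≤ maxHeight m
height≤maxHeight [] = z≤n
height≤maxHeight all3 = ≤-refl
height≤maxHeight {suc m} (0∷ w) = ≤-trans (height≤maxHeight w) (<⇒≤ (maxHeight<maxHeight-suc m))
height≤maxHeight {suc m} (1∷ w) =
  ≤-trans (height-1∷≤ w) (m≤n⇒m≤1+n (+-monoʳ-≤ (gap m) (m≤n⇒m≤1+n (m≤n+m _ (gap m)))))
height≤maxHeight {suc m} (2∷ w) = m≤n⇒m≤1+n (+-monoˡ-≤ _ (aboveFloor≤gap w))

gap≤+2+gap : ∀ m y → gap m ≤ y + suc (suc (gap m))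
gap≤+2+gap m y = m≤n⇒m≤o+n y (m≤n⇒m≤1+n (n≤1+n (gap m)))

aboveFloor-step : {u v : State m} → Move p u v → aboveFloor v ≤ suc (aboveFloor u)
belowTop-step : {u v : State m} → Move p u v → belowTop v ≤ suc (belowTop u)
aboveFloor-step (in0 a) = z≤n
aboveFloor-step (in1 a) = s≤s (belowTop-step a)
aboveFloor-step (in2 a) = +-monoˡ-≤ _ (aboveFloor-step a)
aboveFloor-step {suc m} up01 = s≤s (≤-reflexive (belowTop-threes m))
aboveFloor-step dn10 = z≤n
aboveFloor-step (up12 []) = ≤-refl
aboveFloor-step (up12 (0∷ w)) = ≤-refl
aboveFloor-step {suc m} (dn21 {w = w} _) = s≤s (≤-trans (belowTop≤gap w) (gap≤+2+gap m (aboveFloor w)))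
aboveFloor-step {suc m} up23 = s≤s (+-monoˡ-≤ _ (≤-reflexive (sym (aboveFloor-threes m))))
aboveFloor-step {suc m} dn32 = m≤n⇒m≤1+n (aboveFloor≤gap (2∷ threes m))
belowTop-step (in0 a) = n≤1+n _
belowTop-step (in1 a) = +-monoˡ-≤ _ (aboveFloor-step a)
belowTop-step (in2 a) = s≤s (belowTop-step a)
belowTop-step {suc m} up01 = m≤n⇒m≤1+n (belowTop≤gap (1∷ threes m))
belowTop-step {suc m} dn10 = s≤s (+-monoˡ-≤ _ (≤-reflexive (sym (aboveFloor-threes m))))
belowTop-step {suc m} (up12 {w = w} _) = s≤s (≤-trans (belowTop≤gap w) (gap≤+2+gap m (aboveFloor w)))
belowTop-step (dn21 []) = ≤-refl
belowTop-step (dn21 (0∷ w)) = ≤-refl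
belowTop-step up23 = z≤n
belowTop-step {suc m} dn32 = s≤s (≤-reflexive (belowTop-threes m))

height-step : {u v : State m} → Move p u v → height v ≤ suc (height u)
height-step (in0 a) = height-step a
height-step (in1 a) = +-monoˡ-≤ _ (belowTop-step a)
height-step (in2 a) = +-monoˡ-≤ _ (aboveFloor-step a)
height-step {suc m} up01 = ≤-reflexive (cong₂ _+_ (belowTop-threes m) (cong suc (sym (height-threes m))))
height-step {suc m} dn10 =
  ≤-trans (height≤maxHeight (threes m)) (m≤n⇒m≤1+n (m≤n⇒m≤o+n (belowTop (threes m)) (n≤1+n _)))
height-step (up12 []) = ≤-refl
height-step (up12 (0∷ w)) = ≤-refl
height-step (dn21 {w = w} _) = ≤-trans (height-1∷≤ w) (m≤n⇒m≤1+n (m≤n⇒m≤o+n (aboveFloor w) (n≤1+n _)))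
height-step {suc m} up23 = s≤s (+-monoˡ-≤ _ (≤-reflexive (sym (aboveFloor-threes m))))
height-step {suc m} dn32 = m≤n⇒m≤1+n (height≤maxHeight (2∷ threes m))

≤⇒≢1+ : ∀ {x g} → x ≤ g → x ≢ suc g
≤⇒≢1+ x≤g = <⇒≢ (s≤s x≤g)

≤⇒≢+1+ : ∀ {x g} y → x ≤ g → x ≢ y + suc g
≤⇒≢+1+ y x≤g = <⇒≢ (≤-trans (s≤s x≤g) (m≤n+m _ y))

aboveFloor≢1+gap : (w : State m) → aboveFloor w ≢ suc (gap m)
aboveFloor≢1+gap w = ≤⇒≢1+ (aboveFloor≤gap w)

aboveFloor≢2+gap : (w : State m) → aboveFloor w ≢ suc (suc (gap m))
aboveFloor≢2+gap w = ≤⇒≢1+ (m≤n⇒m≤1+n (aboveFloor≤gap w))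

belowTop≢1+gap : (w : State m) → belowTop w ≢ suc (gap m)
belowTop≢1+gap w = ≤⇒≢1+ (belowTop≤gap w)

belowTop≢+2+gap : (w : State m) (y : ℕ) → belowTop w ≢ y + suc (suc (gap m))
belowTop≢+2+gap w y = ≤⇒≢+1+ y (m≤n⇒m≤1+n (belowTop≤gap w))

height≢1+maxHeight : (w : State m) → height w ≢ suc (maxHeight m)
height≢1+maxHeight w = ≤⇒≢1+ (height≤maxHeight w)

height≢+1+maxHeight : (w : State m) (y : ℕ) → height w ≢ y + suc (maxHeight m)
height≢+1+maxHeight w y = ≤⇒≢+1+ y (height≤maxHeight w)

belowTop≡gap⇒leading0 : (w : State m) → belowTop w ≡ gap m → Leading0 w
belowTop≡gap⇒leading0 [] _ = []
belowTop≡gap⇒leading0 (0∷ w) _ = 0∷ w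
belowTop≡gap⇒leading0 (1∷ w) e = ⊥-elim (aboveFloor≢1+gap w (+-cancelʳ-≡ _ _ _ e))
belowTop≡gap⇒leading0 {suc m} (2∷ w) e = ⊥-elim (belowTop≢+2+gap w (gap m) (suc-injective e))

aboveFloor≡gap⇒threes : (w : State m) → aboveFloor w ≡ gap m → w ≡ threes m
aboveFloor≡gap⇒threes [] _ = refl
aboveFloor≡gap⇒threes all3 _ = refl
aboveFloor≡gap⇒threes {suc m} (1∷ w) e = ⊥-elim (belowTop≢+2+gap w (gap m) (suc-injective e))
aboveFloor≡gap⇒threes (2∷ w) e = ⊥-elim (aboveFloor≢1+gap w (+-cancelʳ-≡ _ _ _ e))

height≡maxHeight⇒threes : (w : State m) → height w ≡ maxHeight m → w ≡ threes m
height≡maxHeight⇒threes [] _ = refl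
height≡maxHeight⇒threes all3 _ = refl
height≡maxHeight⇒threes {suc m} (0∷ w) e =
  ⊥-elim (<⇒≢ (≤-<-trans (height≤maxHeight w) (maxHeight<maxHeight-suc m)) e)
height≡maxHeight⇒threes {suc m} (1∷ w) e = ⊥-elim (≤⇒≢+1+ (suc (gap m)) (height-1∷≤ w) e)
height≡maxHeight⇒threes (2∷ w) e = ⊥-elim (aboveFloor≢1+gap w (+-cancelʳ-≡ _ _ _ e))

belowTop-ascent-greedy : {u v r : State m} → Move p u v → Move q u r →
  belowTop v ≡ suc (belowTop u) → suc (belowTop r) ≢ belowTop u → r ≡ v ⊎ q < p
aboveFloor-ascent-greedy : {u v r : State m} → Move p u v → Move q u r →
  aboveFloor v ≡ suc (aboveFloor u) → suc (aboveFloor r) ≢ aboveFloor u → r ≡ v ⊎ q < p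
belowTop-ascent-greedy dn32 dn32 _ _ = inj₁ refl
belowTop-ascent-greedy (in0 a) _ asc _ = ⊥-elim (1+n≢n (sym asc))
belowTop-ascent-greedy {suc m} up01 _ asc _ = ⊥-elim (belowTop≢1+gap (1∷ threes m) asc)
belowTop-ascent-greedy {suc m} (in1 a) (in1 b) asc nd =
  map₁ (cong 1∷_) (aboveFloor-ascent-greedy a b (+-cancelʳ-≡ _ _ _ asc) (nd ∘ cong (_+ suc (suc (gap m)))))
belowTop-ascent-greedy {suc m} (in1 {v = v} a) dn10 asc _ =
  ⊥-elim (aboveFloor≢1+gap v (trans (+-cancelʳ-≡ _ _ _ asc) (cong suc (aboveFloor-threes m))))
belowTop-ascent-greedy (in1 a) (up12 (0∷ _)) _ nd = ⊥-elim (nd refl)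
belowTop-ascent-greedy dn10 (in1 b) _ _ = inj₂ (Move⇒position< b)
belowTop-ascent-greedy dn10 dn10 _ _ = inj₁ refl
belowTop-ascent-greedy dn10 (up12 []) _ nd = ⊥-elim (nd refl)
belowTop-ascent-greedy (up12 {w = w} _) _ asc _ = ⊥-elim (belowTop≢+2+gap w (aboveFloor w) (suc-injective asc))
belowTop-ascent-greedy (in2 a) (in2 b) asc nd =
  map₁ (cong 2∷_) (belowTop-ascent-greedy a b (suc-injective asc) (nd ∘ cong suc))
belowTop-ascent-greedy {suc m} (in2 a) up23 _ nd = ⊥-elim (nd (cong suc (sym (belowTop-threes m))))
belowTop-ascent-greedy (in2 {v = v} a) (dn21 z) asc _ =
  ⊥-elim (belowTop≢1+gap v (trans (suc-injective asc) (cong suc (belowTop-leading0 z))))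
belowTop-ascent-greedy (dn21 _) (in2 b) _ _ = inj₂ (Move⇒position< b)
belowTop-ascent-greedy (dn21 []) up23 _ nd = ⊥-elim (nd refl)
belowTop-ascent-greedy (dn21 _) (dn21 _) _ _ = inj₁ refl
belowTop-ascent-greedy up23 _ () _
aboveFloor-ascent-greedy dn32 dn32 _ _ = inj₁ refl
aboveFloor-ascent-greedy (in0 a) _ () _
aboveFloor-ascent-greedy up01 (in0 b) _ _ = inj₂ (Move⇒position< b)
aboveFloor-ascent-greedy up01 up01 _ _ = inj₁ refl
aboveFloor-ascent-greedy (in1 a) (in1 b) asc nd =
  map₁ (cong 1∷_) (belowTop-ascent-greedy a b (suc-injective asc) (nd ∘ cong suc))
aboveFloor-ascent-greedy {suc m} (in1 a) dn10 _ nd = ⊥-elim (nd (cong suc (sym (belowTop-threes m))))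
aboveFloor-ascent-greedy (in1 {v = v} a) (up12 z) asc _ =
  ⊥-elim (belowTop≢1+gap v (trans (suc-injective asc) (cong suc (belowTop-leading0 z))))
aboveFloor-ascent-greedy dn10 _ () _
aboveFloor-ascent-greedy (up12 _) (in1 b) _ _ = inj₂ (Move⇒position< b)
aboveFloor-ascent-greedy (up12 []) dn10 _ nd = ⊥-elim (nd refl)
aboveFloor-ascent-greedy (up12 _) (up12 _) _ _ = inj₁ refl
aboveFloor-ascent-greedy {suc m} (in2 a) (in2 b) asc nd =
  map₁ (cong 2∷_) (aboveFloor-ascent-greedy a b (+-cancelʳ-≡ _ _ _ asc) (nd ∘ cong (_+ suc (suc (gap m)))))
aboveFloor-ascent-greedy {suc m} (in2 {v = v} a) up23 asc _ =
  ⊥-elim (aboveFloor≢1+gap v (trans (+-cancelʳ-≡ _ _ _ asc) (cong suc (aboveFloor-threes m))))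
aboveFloor-ascent-greedy (in2 a) (dn21 (0∷ _)) _ nd = ⊥-elim (nd refl)
aboveFloor-ascent-greedy (dn21 {w = w} _) _ asc _ = ⊥-elim (belowTop≢+2+gap w (aboveFloor w) (suc-injective asc))
aboveFloor-ascent-greedy up23 (in2 b) _ _ = inj₂ (Move⇒position< b)
aboveFloor-ascent-greedy up23 up23 _ _ = inj₁ refl
aboveFloor-ascent-greedy up23 (dn21 []) _ nd = ⊥-elim (nd refl)

height-ascent-greedy : {u v r : State m} → Move p u v → Move q u r →
  height v ≡ suc (height u) → suc (height r) ≢ height u → r ≡ v ⊎ q < p
height-ascent-greedy dn32 dn32 _ _ = inj₁ refl
height-ascent-greedy (in0 a) (in0 b) asc nd = map₁ (cong 0∷_) (height-ascent-greedy a b asc nd)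
height-ascent-greedy {suc m} (in0 {v = v} a) up01 asc _ =
  ⊥-elim (height≢1+maxHeight v (trans asc (cong suc (height-threes m))))
height-ascent-greedy up01 (in0 b) _ _ = inj₂ (Move⇒position< b)
height-ascent-greedy up01 up01 _ _ = inj₁ refl
height-ascent-greedy {suc m} (in1 a) (in1 b) asc nd =
  map₁ (cong 1∷_) (belowTop-ascent-greedy a b (+-cancelʳ-≡ _ _ _ asc) (nd ∘ cong (_+ suc (maxHeight m))))
height-ascent-greedy {suc m} (in1 a) dn10 _ nd =
  ⊥-elim (nd (trans (cong suc (height-threes m)) (cong (_+ suc (maxHeight m)) (sym (belowTop-threes m)))))
height-ascent-greedy (in1 {v = v} a) (up12 z) asc _ =
  ⊥-elim (belowTop≢1+gap v (trans (+-cancelʳ-≡ _ _ _ asc) (cong suc (belowTop-leading0 z))))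
height-ascent-greedy {suc m} dn10 _ asc _ =
  ⊥-elim (height≢+1+maxHeight (threes m) (suc (belowTop (threes m))) asc)
height-ascent-greedy (up12 _) (in1 b) _ _ = inj₂ (Move⇒position< b)
height-ascent-greedy (up12 []) dn10 _ nd = ⊥-elim (nd refl)
height-ascent-greedy (up12 _) (up12 _) _ _ = inj₁ refl
height-ascent-greedy {suc m} (in2 a) (in2 b) asc nd =
  map₁ (cong 2∷_)
    (aboveFloor-ascent-greedy a b (+-cancelʳ-≡ _ _ _ asc) (nd ∘ cong (_+ suc (gap m + suc (maxHeight m)))))
height-ascent-greedy {suc m} (in2 {v = v} a) up23 asc _ =
  ⊥-elim (aboveFloor≢1+gap v (trans (+-cancelʳ-≡ _ _ _ asc) (cong suc (aboveFloor-threes m))))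
height-ascent-greedy (in2 a) (dn21 (0∷ _)) _ nd = ⊥-elim (nd refl)
height-ascent-greedy {suc m} (dn21 {w = w} _) _ asc _ = ⊥-elim (≤⇒≢+1+ (suc (aboveFloor w)) (height-1∷≤ w) asc)
height-ascent-greedy up23 (in2 b) _ _ = inj₂ (Move⇒position< b)
height-ascent-greedy up23 up23 _ _ = inj₁ refl
height-ascent-greedy up23 (dn21 []) _ nd = ⊥-elim (nd refl)

ascent≢descent : ∀ {a b : ℕ} → b ≡ suc a → suc b ≢ a
ascent≢descent refl ()

height-ascent-unique : {u v v′ : State m} → Move p u v → Move q u v′ →
  height v ≡ suc (height u) → height v′ ≡ suc (height u) → v ≡ v′
height-ascent-unique a b asc asc′
  with height-ascent-greedy a b asc (ascent≢descent asc′) | height-ascent-greedy b a asc′ (ascent≢descent asc)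
... | inj₁ v′≡v | _ = sym v′≡v
... | inj₂ _ | inj₁ v≡v′ = v≡v′
... | inj₂ q<p | inj₂ p<q = ⊥-elim (<-asym q<p p<q)

belowTop-descent-unique : {u v v′ : State m} → Move p u v → Move q u v′ →
  suc (belowTop v) ≡ belowTop u → suc (belowTop v′) ≡ belowTop u → v ≡ v′
aboveFloor-descent-unique : {u v v′ : State m} → Move p u v → Move q u v′ →
  suc (aboveFloor v) ≡ aboveFloor u → suc (aboveFloor v′) ≡ aboveFloor u → v ≡ v′
belowTop-descent-unique dn32 _ () _
belowTop-descent-unique (in0 a) _ dsc _ = ⊥-elim (1+n≢n dsc)
belowTop-descent-unique up01 (in0 b) _ dsc = ⊥-elim (1+n≢n dsc)
belowTop-descent-unique up01 up01 _ _ = refl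
belowTop-descent-unique (in1 a) (in1 b) dsc dsc′ =
  cong 1∷_ (aboveFloor-descent-unique a b (+-cancelʳ-≡ _ _ _ dsc) (+-cancelʳ-≡ _ _ _ dsc′))
belowTop-descent-unique {suc m} dn10 _ dsc _ = ⊥-elim (aboveFloor≢2+gap (threes m) (sym (+-cancelʳ-≡ _ _ _ dsc)))
belowTop-descent-unique {suc m} _ dn10 _ dsc = ⊥-elim (aboveFloor≢2+gap (threes m) (sym (+-cancelʳ-≡ _ _ _ dsc)))
belowTop-descent-unique (in1 a) (up12 (0∷ _)) dsc _ = ⊥-elim (1+n≢0 (+-cancelʳ-≡ _ _ _ dsc))
belowTop-descent-unique (up12 (0∷ _)) (in1 b) _ dsc = ⊥-elim (1+n≢0 (+-cancelʳ-≡ _ _ _ dsc))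
belowTop-descent-unique (up12 _) (up12 _) _ _ = refl
belowTop-descent-unique (in2 a) (in2 b) dsc dsc′ =
  cong 2∷_ (belowTop-descent-unique a b (suc-injective dsc) (suc-injective dsc′))
belowTop-descent-unique {suc m} (in2 a) up23 dsc _ = ⊥-elim (1+n≢0 (trans (suc-injective dsc) (belowTop-threes m)))
belowTop-descent-unique {suc m} up23 (in2 b) _ dsc = ⊥-elim (1+n≢0 (trans (suc-injective dsc) (belowTop-threes m)))
belowTop-descent-unique up23 up23 _ _ = refl
belowTop-descent-unique (dn21 {w = w} _) _ dsc _ = ⊥-elim (belowTop≢+2+gap w (aboveFloor w) (sym (suc-injective dsc)))
belowTop-descent-unique _ (dn21 {w = w} _) _ dsc = ⊥-elim (belowTop≢+2+gap w (aboveFloor w) (sym (suc-injective dsc)))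
aboveFloor-descent-unique dn32 dn32 _ _ = refl
aboveFloor-descent-unique (in0 a) _ () _
aboveFloor-descent-unique up01 _ () _
aboveFloor-descent-unique (in1 a) (in1 b) dsc dsc′ =
  cong 1∷_ (belowTop-descent-unique a b (suc-injective dsc) (suc-injective dsc′))
aboveFloor-descent-unique {suc m} (in1 a) dn10 dsc _ = ⊥-elim (1+n≢0 (trans (suc-injective dsc) (belowTop-threes m)))
aboveFloor-descent-unique {suc m} dn10 (in1 b) _ dsc = ⊥-elim (1+n≢0 (trans (suc-injective dsc) (belowTop-threes m)))
aboveFloor-descent-unique dn10 dn10 _ _ = refl
aboveFloor-descent-unique (up12 {w = w} _) _ dsc _ =
  ⊥-elim (belowTop≢+2+gap w (aboveFloor w) (sym (suc-injective dsc)))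
aboveFloor-descent-unique _ (up12 {w = w} _) _ dsc =
  ⊥-elim (belowTop≢+2+gap w (aboveFloor w) (sym (suc-injective dsc)))
aboveFloor-descent-unique (in2 a) (in2 b) dsc dsc′ =
  cong 2∷_ (aboveFloor-descent-unique a b (+-cancelʳ-≡ _ _ _ dsc) (+-cancelʳ-≡ _ _ _ dsc′))
aboveFloor-descent-unique {suc m} up23 _ dsc _ = ⊥-elim (aboveFloor≢2+gap (threes m) (sym (+-cancelʳ-≡ _ _ _ dsc)))
aboveFloor-descent-unique {suc m} _ up23 _ dsc = ⊥-elim (aboveFloor≢2+gap (threes m) (sym (+-cancelʳ-≡ _ _ _ dsc)))
aboveFloor-descent-unique (in2 a) (dn21 (0∷ _)) dsc _ = ⊥-elim (1+n≢0 (+-cancelʳ-≡ _ _ _ dsc))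
aboveFloor-descent-unique (dn21 (0∷ _)) (in2 b) _ dsc = ⊥-elim (1+n≢0 (+-cancelʳ-≡ _ _ _ dsc))
aboveFloor-descent-unique (dn21 _) (dn21 _) _ _ = refl

height-descent-unique : {u v v′ : State m} → Move p u v → Move q u v′ →
  suc (height v) ≡ height u → suc (height v′) ≡ height u → v ≡ v′
height-descent-unique dn32 dn32 _ _ = refl
height-descent-unique (in0 a) (in0 b) dsc dsc′ = cong 0∷_ (height-descent-unique a b dsc dsc′)
height-descent-unique {suc m} (in0 {u = w} _) up01 _ dsc =
  ⊥-elim (height≢+1+maxHeight w (suc (belowTop (threes m))) (sym dsc))
height-descent-unique {suc m} up01 _ dsc _ =
  ⊥-elim (height≢+1+maxHeight (threes m) (suc (belowTop (threes m))) (sym dsc))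
height-descent-unique {suc m} (in1 a) (in1 b) dsc dsc′ =
  cong 1∷_ (belowTop-descent-unique a b (+-cancelʳ-≡ _ _ _ dsc) (+-cancelʳ-≡ _ _ _ dsc′))
height-descent-unique {suc m} (in1 a) dn10 dsc _ = ⊥-elim (1+n≢0 (trans (+-cancelʳ-≡ _ _ _ dsc) (belowTop-threes m)))
height-descent-unique {suc m} dn10 (in1 b) _ dsc = ⊥-elim (1+n≢0 (trans (+-cancelʳ-≡ _ _ _ dsc) (belowTop-threes m)))
height-descent-unique dn10 dn10 _ _ = refl
height-descent-unique (up12 {w = w} _) _ dsc _ = ⊥-elim (≤⇒≢+1+ (suc (aboveFloor w)) (height-1∷≤ w) (sym dsc))
height-descent-unique _ (up12 {w = w} _) _ dsc = ⊥-elim (≤⇒≢+1+ (suc (aboveFloor w)) (height-1∷≤ w) (sym dsc))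
height-descent-unique {suc m} (in2 a) (in2 b) dsc dsc′ =
  cong 2∷_ (aboveFloor-descent-unique a b (+-cancelʳ-≡ _ _ _ dsc) (+-cancelʳ-≡ _ _ _ dsc′))
height-descent-unique {suc m} up23 _ dsc _ = ⊥-elim (aboveFloor≢2+gap (threes m) (sym (+-cancelʳ-≡ _ _ _ dsc)))
height-descent-unique {suc m} _ up23 _ dsc = ⊥-elim (aboveFloor≢2+gap (threes m) (sym (+-cancelʳ-≡ _ _ _ dsc)))
height-descent-unique (in2 a) (dn21 (0∷ _)) dsc _ = ⊥-elim (1+n≢0 (+-cancelʳ-≡ _ _ _ dsc))
height-descent-unique (dn21 (0∷ _)) (in2 b) _ dsc = ⊥-elim (1+n≢0 (+-cancelʳ-≡ _ _ _ dsc))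
height-descent-unique (dn21 _) (dn21 _) _ _ = refl

-- OnLadder u: each leading 0 met while stripping leading digits 1 and 2 off u is followed by 3s only.
-- These are the states on the route between 03⋯3 and 3⋯3, along which aboveFloor and belowTop climb.
OnLadder : State m → Set
OnLadder [] = ⊤
OnLadder all3 = ⊤
OnLadder {suc m} (0∷ w) = w ≡ threes m
OnLadder (1∷ w) = OnLadder w
OnLadder (2∷ w) = OnLadder w

OnClimb : State m → Set
OnClimb [] = ⊤
OnClimb all3 = ⊤
OnClimb (0∷ w) = OnClimb w
OnClimb (1∷ w) = OnLadder w
OnClimb (2∷ w) = OnLadder w

threes-onLadder : ∀ m → OnLadder (threes m)
threes-onLadder zero = tt
threes-onLadder (suc m) = tt

zeros-onClimb : ∀ m → OnClimb (zeros m)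
zeros-onClimb zero = tt
zeros-onClimb (suc m) = zeros-onClimb m

Ascent : (State m → ℕ) → (State m → Set) → State m → Set
Ascent {m} f P u = Σ (State m) λ v → Σ ℕ λ p → Move p u v × f v ≡ suc (f u) × P v

-- Either the rest of u can still climb, or it has reached its bound and the leading digit moves.
belowTop-ascent : (u : State m) → OnLadder u → belowTop u < gap m → Ascent belowTop OnLadder u
aboveFloor-ascent : (u : State m) → OnLadder u → aboveFloor u < gap m → Ascent aboveFloor OnLadder u
belowTop-ascent {suc m} all3 _ _ = 2∷ threes m , m , dn32 , cong suc (belowTop-threes m) , threes-onLadder m
belowTop-ascent (0∷ w) _ lt = ⊥-elim (<-irrefl refl lt)
belowTop-ascent {suc m} (1∷ w) on _ with m≤n⇒m<n∨m≡n (aboveFloor≤gap w)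
... | inj₁ lt = let v , p , a , up , on′ = aboveFloor-ascent w on lt
                in 1∷ v , p , in1 a , cong (_+ suc (suc (gap m))) up , on′
... | inj₂ e with aboveFloor≡gap⇒threes w e
...   | refl = 0∷ threes m , m , dn10 , cong (λ x → suc (x + suc (suc (gap m)))) (sym (aboveFloor-threes m)) , refl
belowTop-ascent (2∷ w) on _ with m≤n⇒m<n∨m≡n (belowTop≤gap w)
... | inj₁ lt = let v , p , a , up , on′ = belowTop-ascent w on lt in 2∷ v , p , in2 a , cong suc up , on′
... | inj₂ e with belowTop≡gap⇒leading0 w e
...   | [] = 1∷ [] , 0 , dn21 [] , refl , on
...   | 0∷ x = 1∷ 0∷ x , _ , dn21 (0∷ x) , refl , on
aboveFloor-ascent all3 _ lt = ⊥-elim (<-irrefl refl lt)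
aboveFloor-ascent {suc m} (0∷ w) refl _ = 1∷ threes m , m , up01 , cong suc (belowTop-threes m) , threes-onLadder m
aboveFloor-ascent (1∷ w) on _ with m≤n⇒m<n∨m≡n (belowTop≤gap w)
... | inj₁ lt = let v , p , a , up , on′ = belowTop-ascent w on lt in 1∷ v , p , in1 a , cong suc up , on′
... | inj₂ e with belowTop≡gap⇒leading0 w e
...   | [] = 2∷ [] , 0 , up12 [] , refl , on
...   | 0∷ x = 2∷ 0∷ x , _ , up12 (0∷ x) , refl , on
aboveFloor-ascent {suc m} (2∷ w) on _ with m≤n⇒m<n∨m≡n (aboveFloor≤gap w)
... | inj₁ lt = let v , p , a , up , on′ = aboveFloor-ascent w on lt
                in 2∷ v , p , in2 a , cong (_+ suc (suc (gap m))) up , on′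
... | inj₂ e with aboveFloor≡gap⇒threes w e
...   | refl = all3 , m , up23 , cong (λ x → suc (x + suc (suc (gap m)))) (sym (aboveFloor-threes m)) , tt

height-ascent : (u : State m) → OnClimb u → height u < maxHeight m → Ascent height OnClimb u
height-ascent all3 _ lt = ⊥-elim (<-irrefl refl lt)
height-ascent {suc m} (0∷ w) on _ with m≤n⇒m<n∨m≡n (height≤maxHeight w)
... | inj₁ lt = let v , p , a , up , on′ = height-ascent w on lt in 0∷ v , p , in0 a , up , on′
... | inj₂ e with height≡maxHeight⇒threes w e
...   | refl = 1∷ threes m , m , up01 ,
               cong₂ _+_ (belowTop-threes m) (cong suc (sym (height-threes m))) , threes-onLadder m
height-ascent {suc m} (1∷ w) on _ with m≤n⇒m<n∨m≡n (belowTop≤gap w)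
... | inj₁ lt = let v , p , a , up , on′ = belowTop-ascent w on lt
                in 1∷ v , p , in1 a , cong (_+ suc (maxHeight m)) up , on′
... | inj₂ e with belowTop≡gap⇒leading0 w e
...   | [] = 2∷ [] , 0 , up12 [] , refl , on
...   | 0∷ x = 2∷ 0∷ x , _ , up12 (0∷ x) , refl , on
height-ascent {suc m} (2∷ w) on _ with m≤n⇒m<n∨m≡n (aboveFloor≤gap w)
... | inj₁ lt = let v , p , a , up , on′ = aboveFloor-ascent w on lt
                in 2∷ v , p , in2 a , cong (_+ suc (gap m + suc (maxHeight m))) up , on′
... | inj₂ e with aboveFloor≡gap⇒threes w e
...   | refl =
  all3 , m , up23 , cong (λ x → suc (x + suc (gap m + suc (maxHeight m)))) (sym (aboveFloor-threes m)) , tt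

-- Walks

_⟶_ : State m → State m → Set
u ⟶ v = ∃ λ p → Move p u v

Climb : State m → State m → Set
Climb u v = u ⟶ v × height v ≡ suc (height u)

walk-long : {x : State m} {xs : List (State m)} → Linked _⟶_ (x ∷ xs) →
  last (x ∷ xs) ≡ just (threes m) → maxHeight m ≤ height x + length xs
walk-long {m} {x} [-] reaches = ≤-reflexive (begin
  maxHeight m       ≡⟨ sym (height-threes m) ⟩
  height (threes m) ≡⟨ cong height (sym (just-injective reaches)) ⟩
  height x          ≡⟨ sym (+-identityʳ (height x)) ⟩
  height x + 0      ∎)
  where open ≡-Reasoning
walk-long {m} {x} {y ∷ ys} ((_ , a) ∷ walk) reaches = begin
  maxHeight m                ≤⟨ walk-long walk reaches ⟩
  height y + length ys       ≤⟨ +-monoˡ-≤ (length ys) (height-step a) ⟩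
  suc (height x + length ys) ≡⟨ sym (+-suc (height x) (length ys)) ⟩
  height x + length (y ∷ ys) ∎
  where open ≤-Reasoning

short-walk-climbs : {x : State m} {xs : List (State m)} → Linked _⟶_ (x ∷ xs) →
  last (x ∷ xs) ≡ just (threes m) → height x + length xs ≤ maxHeight m → Linked Climb (x ∷ xs)
short-walk-climbs [-] _ _ = [-]
short-walk-climbs {m} {x} {y ∷ ys} (x⟶y@(_ , a) ∷ walk) reaches short =
  (x⟶y , climbs) ∷ short-walk-climbs walk reaches (subst (_≤ maxHeight m) shift short)
  where
  climbs : height y ≡ suc (height x)
  climbs = ≤-antisym (height-step a) (+-cancelʳ-≤ (length ys) _ _ (begin
    suc (height x) + length ys ≡⟨ sym (+-suc (height x) (length ys)) ⟩
    height x + length (y ∷ ys) ≤⟨ short ⟩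
    maxHeight m                ≤⟨ walk-long walk reaches ⟩
    height y + length ys       ∎))
    where open ≤-Reasoning
  shift : height x + length (y ∷ ys) ≡ height y + length ys
  shift = trans (+-suc (height x) (length ys)) (cong (_+ length ys) (sym climbs))

climb-unique : {x : State m} {xs ys : List (State m)} →
  Linked Climb (x ∷ xs) → Linked Climb (x ∷ ys) → length xs ≡ length ys → xs ≡ ys
climb-unique [-] [-] _ = refl
climb-unique (((_ , a) , up) ∷ climbs) (((_ , b) , up′) ∷ climbs′) same-length
  with height-ascent-unique a b up up′
... | refl = cong (_ ∷_) (climb-unique climbs climbs′ (suc-injective same-length))

climb⇒Unique : {xs : List (State m)} → Linked Climb xs → Unique xs
climb⇒Unique climbs =
  AllPairs.map (λ lt eq → <-irrefl (cong height eq) lt)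
    (Linked⇒AllPairs <-trans (Linked.map (λ (_ , up) → ≤-reflexive (sym up)) climbs))

climb : (k : ℕ) (u : State m) → OnClimb u → height u + k ≡ maxHeight m →
  Σ (List (State m)) λ xs → Linked Climb (u ∷ xs) × length xs ≡ k × last (u ∷ xs) ≡ just (threes m)
climb zero u _ reach with height≡maxHeight⇒threes u (trans (sym (+-identityʳ _)) reach)
... | refl = [] , [-] , refl , refl
climb (suc k) u on reach with height-ascent u on (subst (height u <_) reach (m<m+n (height u) (s≤s z≤n)))
... | v , p , a , up , on′ with climb k v on′ (trans (cong (_+ k) up) (trans (sym (+-suc (height u) k)) reach))
...   | xs , climbs , len , reaches = v ∷ xs , ((p , a) , up) ∷ climbs , cong suc len , reaches

climb-from-zeros : ∀ m → Σ (List (State m)) λ xs →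
  Linked Climb (zeros m ∷ xs) × length xs ≡ maxHeight m × last (zeros m ∷ xs) ≡ just (threes m)
climb-from-zeros m = climb (maxHeight m) (zeros m) (zeros-onClimb m) (cong (_+ maxHeight m) (height-zeros m))

-- States as words

lookup-∷ʳ-fromℕ : (xs : Vec A m) (x : A) → lookup (xs ∷ʳ x) (fromℕ m) ≡ x
lookup-∷ʳ-fromℕ [] x = refl
lookup-∷ʳ-fromℕ (_ ∷ xs) x = lookup-∷ʳ-fromℕ xs x

lookup-∷ʳ-inject₁ : (xs : Vec A m) (x : A) (j : Fin m) → lookup (xs ∷ʳ x) (inject₁ j) ≡ lookup xs j
lookup-∷ʳ-inject₁ (_ ∷ xs) x zero = refl
lookup-∷ʳ-inject₁ (_ ∷ xs) x (suc j) = lookup-∷ʳ-inject₁ xs x j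

lookup-ext : (xs ys : Vec A m) → (∀ j → lookup xs j ≡ lookup ys j) → xs ≡ ys
lookup-ext xs ys eq = trans (sym (tabulate∘lookup xs)) (trans (tabulate-cong eq) (tabulate∘lookup ys))

replicate-∷ʳ : ∀ m (x : A) → replicate m x ∷ʳ x ≡ replicate (suc m) x
replicate-∷ʳ zero x = refl
replicate-∷ʳ (suc m) x = cong (x ∷_) (replicate-∷ʳ m x)

toℕ-inject₁< : (j : Fin m) → toℕ (inject₁ j) < m
toℕ-inject₁< j = subst (_< _) (sym (toℕ-inject₁ j)) (toℕ<n j)

inject₁<fromℕ : (j : Fin m) → toℕ (inject₁ j) < toℕ (fromℕ m)
inject₁<fromℕ {m} j = subst (toℕ (inject₁ j) <_) (sym (toℕ-fromℕ m)) (toℕ-inject₁< j)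

-- The leading digit goes last: position zero of a Word holds the rightmost digit.
encode : State m → Word m
encode [] = []
encode {suc m} all3 = encode (threes m) ∷ʳ three
encode (0∷ w) = encode w ∷ʳ zero
encode (1∷ w) = encode w ∷ʳ suc zero
encode (2∷ w) = encode w ∷ʳ suc (suc zero)

lead : State (suc m) → Fin 4
lead all3 = three
lead (0∷ _) = zero
lead (1∷ _) = suc zero
lead (2∷ _) = suc (suc zero)

rest : State (suc m) → State m
rest {m} all3 = threes m
rest (0∷ w) = w
rest (1∷ w) = w
rest (2∷ w) = w

-- A leading 3 forces all digits to be 3, so the rest is ignored there.
_◂_ : Fin 4 → State m → State (suc m)
zero ◂ w = 0∷ w
suc zero ◂ w = 1∷ w
suc (suc zero) ◂ w = 2∷ w
suc (suc (suc zero)) ◂ w = all3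

lead◂rest : (u : State (suc m)) → lead u ◂ rest u ≡ u
lead◂rest all3 = refl
lead◂rest (0∷ _) = refl
lead◂rest (1∷ _) = refl
lead◂rest (2∷ _) = refl

◂-rest : (u : State (suc m)) {d : Fin 4} → lead u ≡ d → d ◂ rest u ≡ u
◂-rest u refl = lead◂rest u

encode-∷ʳ : (u : State (suc m)) → encode u ≡ encode (rest u) ∷ʳ lead u
encode-∷ʳ all3 = refl
encode-∷ʳ (0∷ _) = refl
encode-∷ʳ (1∷ _) = refl
encode-∷ʳ (2∷ _) = refl

encode-injective : {u v : State m} → encode u ≡ encode v → u ≡ v
encode-injective {zero} {[]} {[]} _ = refl
encode-injective {suc m} {u} {v} e
  with ∷ʳ-injective (encode (rest u)) (encode (rest v)) (trans (sym (encode-∷ʳ u)) (trans e (encode-∷ʳ v)))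
... | rests , leads = trans (sym (lead◂rest u)) (trans (cong₂ _◂_ leads (encode-injective rests)) (lead◂rest v))

encode-threes : ∀ m → encode (threes m) ≡ top m
encode-threes zero = refl
encode-threes (suc m) = trans (cong (_∷ʳ three) (encode-threes m)) (replicate-∷ʳ m three)

encode-zeros : ∀ m → encode (zeros m) ≡ bottom m
encode-zeros zero = refl
encode-zeros (suc m) = trans (cong (_∷ʳ zero) (encode-zeros m)) (replicate-∷ʳ m zero)

-- The leading digit of q is d; vacuous for the empty word.
LeadIs : Word m → Fin 4 → Set
LeadIs {m} q d = ∀ j → suc (toℕ j) ≡ m → lookup q j ≡ d

leadIs-∷ʳ : (xs : Word m) (d : Fin 4) → LeadIs (xs ∷ʳ d) d
leadIs-∷ʳ xs d j e with view j
... | ‵fromℕ = lookup-∷ʳ-fromℕ xs d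
... | ‵inject₁ j′ = ⊥-elim (<-irrefl (suc-injective e) (toℕ-inject₁< j′))

leadIs-∷ʳ⁻ : (xs : Word m) {d e : Fin 4} → LeadIs (xs ∷ʳ d) e → d ≡ e
leadIs-∷ʳ⁻ {m} xs leads-e = trans (sym (lookup-∷ʳ-fromℕ xs _)) (leads-e (fromℕ m) (cong suc (toℕ-fromℕ m)))

leadIs-threes : ∀ m → LeadIs (encode (threes m)) three
leadIs-threes zero ()
leadIs-threes (suc m) = leadIs-∷ʳ (encode (threes m)) three

leadIs-leading0 : {w : State m} → Leading0 w → LeadIs (encode w) zero
leadIs-leading0 [] ()
leadIs-leading0 (0∷ x) = leadIs-∷ʳ (encode x) zero

leadIs3⇒threes : (w : State m) → LeadIs (encode w) three → w ≡ threes m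
leadIs3⇒threes [] _ = refl
leadIs3⇒threes all3 _ = refl
leadIs3⇒threes (0∷ x) l with leadIs-∷ʳ⁻ (encode x) l
... | ()
leadIs3⇒threes (1∷ x) l with leadIs-∷ʳ⁻ (encode x) l
... | ()
leadIs3⇒threes (2∷ x) l with leadIs-∷ʳ⁻ (encode x) l
... | ()

leadIs0⇒leading0 : (w : State m) → LeadIs (encode w) zero → Leading0 w
leadIs0⇒leading0 [] _ = []
leadIs0⇒leading0 (0∷ x) _ = 0∷ x
leadIs0⇒leading0 {suc m} all3 l with leadIs-∷ʳ⁻ (encode (threes m)) l
... | ()
leadIs0⇒leading0 (1∷ x) l with leadIs-∷ʳ⁻ (encode x) l
... | ()
leadIs0⇒leading0 (2∷ x) l with leadIs-∷ʳ⁻ (encode x) l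
... | ()

isState-∷ʳ : (xs : Word m) {d : Fin 4} → d ≢ three → IsState xs → IsState (xs ∷ʳ d)
isState-∷ʳ xs {d} d≢3 st i j j<i qi≡3 with view i | view j
... | ‵fromℕ | _ = ⊥-elim (d≢3 (trans (sym (lookup-∷ʳ-fromℕ xs d)) qi≡3))
... | ‵inject₁ i′ | ‵fromℕ = ⊥-elim (<-irrefl refl (<-trans (inject₁<fromℕ i′) j<i))
... | ‵inject₁ i′ | ‵inject₁ j′ =
  trans (lookup-∷ʳ-inject₁ xs d j′)
    (st i′ j′ (subst₂ _<_ (toℕ-inject₁ j′) (toℕ-inject₁ i′) j<i)
        (trans (sym (lookup-∷ʳ-inject₁ xs d i′)) qi≡3))

isState-∷ʳ⁻ : (xs : Word m) {d : Fin 4} → IsState (xs ∷ʳ d) → IsState xs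
isState-∷ʳ⁻ xs {d} st i j j<i qi≡3 =
  trans (sym (lookup-∷ʳ-inject₁ xs d j))
    (st (inject₁ i) (inject₁ j) (subst₂ _<_ (sym (toℕ-inject₁ j)) (sym (toℕ-inject₁ i)) j<i)
        (trans (lookup-∷ʳ-inject₁ xs d i) qi≡3))

isState-∷ʳ3⇒leadIs3 : (xs : Word m) → IsState (xs ∷ʳ three) → LeadIs xs three
isState-∷ʳ3⇒leadIs3 {m} xs st j _ =
  trans (sym (lookup-∷ʳ-inject₁ xs three j))
    (st (fromℕ m) (inject₁ j) (inject₁<fromℕ j) (lookup-∷ʳ-fromℕ xs three))

encode-isState : (u : State m) → IsState (encode u)
encode-isState {suc m} all3 _ j _ _ =
  trans (cong (λ q → lookup q j) (encode-threes (suc m))) (lookup-replicate j three)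
encode-isState (0∷ w) = isState-∷ʳ (encode w) (λ ()) (encode-isState w)
encode-isState (1∷ w) = isState-∷ʳ (encode w) (λ ()) (encode-isState w)
encode-isState (2∷ w) = isState-∷ʳ (encode w) (λ ()) (encode-isState w)

decode-∷ʳ : (w : State m) (d : Fin 4) → IsState (encode w ∷ʳ d) →
  Σ (State (suc m)) λ u → encode u ≡ encode w ∷ʳ d
decode-∷ʳ w zero _ = 0∷ w , refl
decode-∷ʳ w (suc zero) _ = 1∷ w , refl
decode-∷ʳ w (suc (suc zero)) _ = 2∷ w , refl
decode-∷ʳ w (suc (suc (suc zero))) st =
  all3 , cong (λ x → encode x ∷ʳ three) (sym (leadIs3⇒threes w (isState-∷ʳ3⇒leadIs3 (encode w) st)))

decode : (q : Word m) → IsState q → Σ (State m) λ u → encode u ≡ q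
decode [] _ = [] , refl
decode {suc m} q st with initLast q
... | xs , d , refl with decode xs (isState-∷ʳ⁻ xs st)
...   | w , refl = decode-∷ʳ w d st

decode-all : (t : List (Word m)) → All IsState t → Σ (List (State m)) λ us → map encode us ≡ t
decode-all [] [] = [] , refl
decode-all (q ∷ t) (st ∷ sts) with decode q st | decode-all t sts
... | u , refl | us , refl = u ∷ us , refl

Step : Fin 3 → Fin 4 → Fin 4 → Set
Step a x y = (x ≡ inject₁ a × y ≡ suc a) ⊎ (x ≡ suc a × y ≡ inject₁ a)

AdjAt-inject₁⁺ : {i : Fin m} (xs ys : Word m) (d : Fin 4) →
  AdjAt i xs ys → AdjAt (inject₁ i) (xs ∷ʳ d) (ys ∷ʳ d)
AdjAt-inject₁⁺ {m} {i} xs ys d (a , agree , digits , below) =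
  a , agree′ , subst₂ (Step a) (sym (lookup-∷ʳ-inject₁ xs d i)) (sym (lookup-∷ʳ-inject₁ ys d i)) digits ,
  below′
  where
  agree′ : ∀ j → j ≢ inject₁ i → lookup (xs ∷ʳ d) j ≡ lookup (ys ∷ʳ d) j
  agree′ j j≢i with view j
  ... | ‵fromℕ = trans (lookup-∷ʳ-fromℕ xs d) (sym (lookup-∷ʳ-fromℕ ys d))
  ... | ‵inject₁ j′ =
    trans (lookup-∷ʳ-inject₁ xs d j′)
      (trans (agree j′ (j≢i ∘ cong inject₁)) (sym (lookup-∷ʳ-inject₁ ys d j′)))
  below′ : ∀ j → suc (toℕ j) ≡ toℕ (inject₁ i) → lookup (xs ∷ʳ d) j ≡ required a
  below′ j e with view j
  ... | ‵fromℕ =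
    ⊥-elim (<-irrefl (trans (sym e) (cong suc (toℕ-fromℕ m))) (<-trans (toℕ-inject₁< i) (n<1+n m)))
  ... | ‵inject₁ j′ =
    trans (lookup-∷ʳ-inject₁ xs d j′)
      (below j′ (subst₂ (λ x y → suc x ≡ y) (toℕ-inject₁ j′) (toℕ-inject₁ i) e))

AdjAt-inject₁⁻ : {i : Fin m} (xs ys : Word m) (d d′ : Fin 4) →
  AdjAt (inject₁ i) (xs ∷ʳ d) (ys ∷ʳ d′) → AdjAt i xs ys × d ≡ d′
AdjAt-inject₁⁻ {m} {i} xs ys d d′ (a , agree , digits , below) =
  (a , agree′ , subst₂ (Step a) (lookup-∷ʳ-inject₁ xs d i) (lookup-∷ʳ-inject₁ ys d′ i) digits , below′) ,
  trans (sym (lookup-∷ʳ-fromℕ xs d)) (trans (agree (fromℕ m) fromℕ≢inject₁) (lookup-∷ʳ-fromℕ ys d′))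
  where
  agree′ : ∀ j → j ≢ i → lookup xs j ≡ lookup ys j
  agree′ j j≢i =
    trans (sym (lookup-∷ʳ-inject₁ xs d j))
      (trans (agree (inject₁ j) (j≢i ∘ inject₁-injective)) (lookup-∷ʳ-inject₁ ys d′ j))
  below′ : ∀ j → suc (toℕ j) ≡ toℕ i → lookup xs j ≡ required a
  below′ j e =
    trans (sym (lookup-∷ʳ-inject₁ xs d j))
      (below (inject₁ j) (subst₂ (λ x y → suc x ≡ y) (sym (toℕ-inject₁ j)) (sym (toℕ-inject₁ i)) e))

AdjAt-fromℕ⁺ : (xs : Word m) {d d′ : Fin 4} (a : Fin 3) → Step a d d′ → LeadIs xs (required a) →
  AdjAt (fromℕ m) (xs ∷ʳ d) (xs ∷ʳ d′)
AdjAt-fromℕ⁺ {m} xs {d} {d′} a digits lead =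
  a , agree , subst₂ (Step a) (sym (lookup-∷ʳ-fromℕ xs d)) (sym (lookup-∷ʳ-fromℕ xs d′)) digits , below
  where
  agree : ∀ j → j ≢ fromℕ m → lookup (xs ∷ʳ d) j ≡ lookup (xs ∷ʳ d′) j
  agree j j≢top with view j
  ... | ‵fromℕ = ⊥-elim (j≢top refl)
  ... | ‵inject₁ j′ = trans (lookup-∷ʳ-inject₁ xs d j′) (sym (lookup-∷ʳ-inject₁ xs d′ j′))
  below : ∀ j → suc (toℕ j) ≡ toℕ (fromℕ m) → lookup (xs ∷ʳ d) j ≡ required a
  below j e with view j
  ... | ‵fromℕ = ⊥-elim (<-irrefl (sym e) (n<1+n _))
  ... | ‵inject₁ j′ =
    trans (lookup-∷ʳ-inject₁ xs d j′)
      (lead j′ (subst₂ (λ x y → suc x ≡ y) (toℕ-inject₁ j′) (toℕ-fromℕ m) e))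

AdjAt-fromℕ⁻ : (xs ys : Word m) (d d′ : Fin 4) → AdjAt (fromℕ m) (xs ∷ʳ d) (ys ∷ʳ d′) →
  xs ≡ ys × Σ (Fin 3) λ a → Step a d d′ × LeadIs xs (required a)
AdjAt-fromℕ⁻ {m} xs ys d d′ (a , agree , digits , below) =
  lookup-ext xs ys agree′ , a ,
  subst₂ (Step a) (lookup-∷ʳ-fromℕ xs d) (lookup-∷ʳ-fromℕ ys d′) digits , leading
  where
  agree′ : ∀ j → lookup xs j ≡ lookup ys j
  agree′ j =
    trans (sym (lookup-∷ʳ-inject₁ xs d j))
      (trans (agree (inject₁ j) (fromℕ≢inject₁ ∘ sym)) (lookup-∷ʳ-inject₁ ys d′ j))
  leading : LeadIs xs (required a)
  leading j e =
    trans (sym (lookup-∷ʳ-inject₁ xs d j))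
      (below (inject₁ j) (subst₂ (λ x y → suc x ≡ y) (sym (toℕ-inject₁ j)) (sym (toℕ-fromℕ m)) e))

AdjAt-behind : (xs ys : Word m) (d : Fin 4) → Σ (Fin m) (λ i → toℕ i ≡ p × AdjAt i xs ys) →
  Σ (Fin (suc m)) λ i → toℕ i ≡ p × AdjAt i (xs ∷ʳ d) (ys ∷ʳ d)
AdjAt-behind xs ys d (i , i≡p , adj) = inject₁ i , trans (toℕ-inject₁ i) i≡p , AdjAt-inject₁⁺ xs ys d adj

AdjAt-lead : (xs : Word m) {d d′ : Fin 4} (a : Fin 3) → Step a d d′ → LeadIs xs (required a) →
  Σ (Fin (suc m)) λ i → toℕ i ≡ m × AdjAt i (xs ∷ʳ d) (xs ∷ʳ d′)
AdjAt-lead {m} xs a digits leading = fromℕ m , toℕ-fromℕ m , AdjAt-fromℕ⁺ xs a digits leading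

Move⇒AdjAt : {u v : State m} → Move p u v → Σ (Fin m) λ i → toℕ i ≡ p × AdjAt i (encode u) (encode v)
Move⇒AdjAt (in0 {u = u} {v} a) = AdjAt-behind (encode u) (encode v) zero (Move⇒AdjAt a)
Move⇒AdjAt (in1 {u = u} {v} a) = AdjAt-behind (encode u) (encode v) (suc zero) (Move⇒AdjAt a)
Move⇒AdjAt (in2 {u = u} {v} a) = AdjAt-behind (encode u) (encode v) (suc (suc zero)) (Move⇒AdjAt a)
Move⇒AdjAt {suc m} up01 = AdjAt-lead (encode (threes m)) zero (inj₁ (refl , refl)) (leadIs-threes m)
Move⇒AdjAt {suc m} dn10 = AdjAt-lead (encode (threes m)) zero (inj₂ (refl , refl)) (leadIs-threes m)
Move⇒AdjAt (up12 {w = w} z) = AdjAt-lead (encode w) (suc zero) (inj₁ (refl , refl)) (leadIs-leading0 z)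
Move⇒AdjAt (dn21 {w = w} z) = AdjAt-lead (encode w) (suc zero) (inj₂ (refl , refl)) (leadIs-leading0 z)
Move⇒AdjAt {suc m} up23 = AdjAt-lead (encode (threes m)) (suc (suc zero)) (inj₁ (refl , refl)) (leadIs-threes m)
Move⇒AdjAt {suc m} dn32 = AdjAt-lead (encode (threes m)) (suc (suc zero)) (inj₂ (refl , refl)) (leadIs-threes m)

Move-behind : (u v : State (suc m)) → lead u ≡ lead v → Move p (rest u) (rest v) → Move p u v
Move-behind (0∷ _) (0∷ _) refl a = in0 a
Move-behind (1∷ _) (1∷ _) refl a = in1 a
Move-behind (2∷ _) (2∷ _) refl a = in2 a
Move-behind all3 all3 refl a = ⊥-elim (Move-irrefl a)

Move-lead : (a : Fin 3) (w : State m) → LeadIs (encode w) (required a) → Move m (inject₁ a ◂ w) (suc a ◂ w)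
Move-lead zero w leading with leadIs3⇒threes w leading
... | refl = up01
Move-lead (suc zero) w leading = up12 (leadIs0⇒leading0 w leading)
Move-lead (suc (suc zero)) w leading with leadIs3⇒threes w leading
... | refl = up23

AdjAt⇒Move : (i : Fin m) (u v : State m) → AdjAt i (encode u) (encode v) → Move (toℕ i) u v
AdjAt⇒Move {suc m} i u v adj with view i | subst₂ (AdjAt i) (encode-∷ʳ u) (encode-∷ʳ v) adj
... | ‵inject₁ j | adj′ with AdjAt-inject₁⁻ (encode (rest u)) (encode (rest v)) (lead u) (lead v) adj′
...   | adj″ , leads =
  subst (λ p → Move p u v) (sym (toℕ-inject₁ j)) (Move-behind u v leads (AdjAt⇒Move j (rest u) (rest v) adj″))
AdjAt⇒Move {suc m} i u v adj | ‵fromℕ | adj′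
  with AdjAt-fromℕ⁻ (encode (rest u)) (encode (rest v)) (lead u) (lead v) adj′
... | rests , a , digits , leading = subst (λ p → Move p u v) (sym (toℕ-fromℕ m)) (move digits)
  where
  move : Step a (lead u) (lead v) → Move m u v
  move (inj₁ (du , dv)) =
    subst₂ (Move m) (◂-rest u du) (trans (cong (suc a ◂_) (encode-injective rests)) (◂-rest v dv))
      (Move-lead a (rest u) leading)
  move (inj₂ (du , dv)) =
    subst₂ (Move m) (◂-rest u du) (trans (cong (inject₁ a ◂_) (encode-injective rests)) (◂-rest v dv))
      (Move-sym (Move-lead a (rest u) leading))

-- Solutions

ArrivedFrom : Maybe (State m) → State m → Set
ArrivedFrom nothing c = height c ≡ 0
ArrivedFrom (just b) c = c ⟶ b × suc (height b) ≡ height c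

NotPrev⇒not-descent : {pr : Maybe (State m)} {c r : State m} → ArrivedFrom pr c → Move q c r →
  NotPrev (Maybe.map encode pr) (encode r) → suc (height r) ≢ height c
NotPrev⇒not-descent {pr = nothing} c-bottom _ _ desc = 1+n≢0 (trans desc c-bottom)
NotPrev⇒not-descent {pr = just b} ((_ , c⟶b) , b-desc) a r≢b desc =
  r≢b (cong encode (height-descent-unique a c⟶b desc b-desc))

ascent⇒NotPrev : {pr : Maybe (State m)} {c y : State m} → ArrivedFrom pr c → height y ≡ suc (height c) →
  NotPrev (Maybe.map encode pr) (encode y)
ascent⇒NotPrev {pr = nothing} _ _ = tt
ascent⇒NotPrev {pr = just b} {y = y} (_ , b-desc) up y≡b =
  ascent≢descent up (trans (cong (suc ∘ height) (encode-injective {u = y} {b} y≡b)) b-desc)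

ascent⇒GreedyMove : {pr : Maybe (State m)} {c y : State m} → Move p c y → height y ≡ suc (height c) →
  ArrivedFrom pr c → GreedyMove (Maybe.map encode pr) (encode c) (encode y)
ascent⇒GreedyMove {pr = pr} {c} {y} a up arrived with Move⇒AdjAt a
... | i , i≡p , adj = encode-isState y , ascent⇒NotPrev {pr = pr} {c} {y} arrived up , i , adj , highest
  where
  highest : ∀ j r → IsState r → AdjAt j (encode c) r → NotPrev (Maybe.map encode pr) r → toℕ j ≤ toℕ i
  highest j r st adj′ not-prev with decode r st
  ... | r′ , refl with AdjAt⇒Move j c r′ adj′
  ...   | b with height-ascent-greedy a b up (NotPrev⇒not-descent arrived b not-prev)
  ...     | inj₁ refl = ≤-reflexive (trans (Move-position-unique b a) (sym i≡p))
  ...     | inj₂ j<p = <⇒≤ (subst (toℕ j <_) (sym i≡p) j<p)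

climb⇒GreedyWalk : {pr : Maybe (State m)} {c : State m} {xs : List (State m)} →
  Linked Climb (c ∷ xs) → last (c ∷ xs) ≡ just (threes m) → ArrivedFrom pr c →
  GreedyWalk (Maybe.map encode pr) (encode c) (map encode xs)
climb⇒GreedyWalk {m} {pr} [-] reaches _ with just-injective reaches
... | refl = subst (λ t → GreedyWalk (Maybe.map encode pr) t []) (sym (encode-threes m)) stop
climb⇒GreedyWalk {m} {c = c} {y ∷ _} (((p , a) , up) ∷ climbs) reaches arrived =
  step c≢top (ascent⇒GreedyMove a up arrived) (climb⇒GreedyWalk climbs reaches ((p , Move-sym a) , sym up))
  where
  c≢top : encode c ≢ top m
  c≢top c≡top with encode-injective {u = c} {threes m} (trans c≡top (sym (encode-threes m)))
  ... | refl = height≢1+maxHeight y (trans up (cong suc (height-threes m)))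

climb⇒Greedy : {xs : List (State m)} →
  Linked Climb (zeros m ∷ xs) → last (zeros m ∷ xs) ≡ just (threes m) → Greedy (map encode (zeros m ∷ xs))
climb⇒Greedy {m} {xs} climbs reaches =
  subst (λ b → Greedy (b ∷ map encode xs)) (sym (encode-zeros m))
    (start (subst (λ b → GreedyWalk nothing b (map encode xs)) (encode-zeros m)
      (climb⇒GreedyWalk climbs reaches (height-zeros m))))

climb⇒Solution : {xs : List (State m)} →
  Linked Climb (zeros m ∷ xs) → last (zeros m ∷ xs) ≡ just (threes m) → Solution (map encode (zeros m ∷ xs))
climb⇒Solution {m} {xs} climbs reaches =
  All-map⁺ (universal encode-isState (zeros m ∷ xs)) ,
  Unique-map⁺ encode-injective (climb⇒Unique climbs) ,
  Linked-map⁺ (Linked.map (λ ((_ , a) , _) → let i , _ , adj = Move⇒AdjAt a in i , adj) climbs) ,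
  cong just (encode-zeros m) ,
  trans (last-map encode (zeros m ∷ xs)) (trans (cong (Maybe.map encode) reaches) (cong just (encode-threes m)))

Solution⇒walk : (t : List (Word m)) → Solution t → Σ (List (State m)) λ xs →
  t ≡ map encode (zeros m ∷ xs) × Linked _⟶_ (zeros m ∷ xs) × last (zeros m ∷ xs) ≡ just (threes m)
Solution⇒walk [] (_ , _ , _ , () , _)
Solution⇒walk {m} (q ∷ t) (st ∷ sts , _ , linked , starts , ends) with decode q st | decode-all t sts
... | x , refl | xs , refl
  with encode-injective {u = x} {zeros m} (trans (just-injective starts) (sym (encode-zeros m)))
...   | refl =
  xs , refl ,
  Linked.map (λ {u} {v} (i , adj) → toℕ i , AdjAt⇒Move i u v adj) (Linked-map⁻ linked) ,
  map-injective encode-injective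
    (trans (sym (last-map encode (x ∷ xs))) (trans ends (cong just (sym (encode-threes m)))))

Solution-long : {t : List (Word m)} → Solution t → suc (maxHeight m) ≤ length t
Solution-long {m} {t} sol with Solution⇒walk t sol
... | xs , refl , walk , reaches =
  subst (suc (maxHeight m) ≤_) (sym (length-map encode (zeros m ∷ xs)))
    (s≤s (subst (λ h → maxHeight m ≤ h + length xs) (height-zeros m) (walk-long walk reaches)))

Solution-short⇒climb : {t : List (Word m)} → Solution t → length t ≡ suc (maxHeight m) →
  Σ (List (State m)) λ xs →
    t ≡ map encode (zeros m ∷ xs) × Linked Climb (zeros m ∷ xs) × length xs ≡ maxHeight m
Solution-short⇒climb {m} {t} sol short with Solution⇒walk t sol
... | xs , refl , walk , reaches =
  xs , refl , short-walk-climbs walk reaches (≤-reflexive (cong₂ _+_ (height-zeros m) len)) , len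
  where
  len : length xs ≡ maxHeight m
  len = suc-injective (trans (sym (length-map encode (zeros m ∷ xs))) short)

mainTheorem5 : (n : ℕ) → n ≥ 1 →
    Σ (List (Word n)) λ s →
      Solution s × Greedy s
      × (∀ (t : List (Word n)) → Solution t → length s ≤ length t)
      × (∀ (t : List (Word n)) → Solution t → length t ≡ length s → t ≡ s)
mainTheorem5 n _ with climb-from-zeros n
... | xs , climbs , len , reaches =
  s , climb⇒Solution climbs reaches , climb⇒Greedy climbs reaches , shortest , unique
  where
  s : List (Word n)
  s = map encode (zeros n ∷ xs)
  length-s : length s ≡ suc (maxHeight n)
  length-s = trans (length-map encode (zeros n ∷ xs)) (cong suc len)
  shortest : ∀ t → Solution t → length s ≤ length t
  shortest t sol = subst (_≤ length t) (sym length-s) (Solution-long sol)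
  unique : ∀ t → Solution t → length t ≡ length s → t ≡ s
  unique t sol same with Solution-short⇒climb sol (trans same length-s)
  ... | ys , refl , climbs′ , len′ =
    cong (λ zs → map encode (zeros n ∷ zs)) (climb-unique climbs′ climbs (trans len′ (sym len)))
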